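{- Let $S$ be an opetopic cardinal whose associated positive-to-one poset has a greatest element (for the order $\le$). Then $S$ is principal, i.e. $S$ is a positive opetope.
   Context: A positive hypergraph $S$ consists of finite sets $S_k$ ($k\in\mathbb{N}$), all but finitely many empty, and maps $\gamma:S_{k+1}\to S_k$, $\delta:S_{k+1}\to\mathcal{P}(S_k)$ with $\delta(a)\neq\emptyset$ for all $a$ and $\delta(a)$ a singleton for $a\in S_1$; $\dim S=\max\{k:S_k\ne\emptyset\}$. For $a\in S_{k+2}$: $\gamma\gamma(a)=\{\gamma(\gamma(a))\}$, $\gamma\delta(a)=\{\gamma(x):x\in\delta(a)\}$, $\delta\gamma(a)=\delta(\gamma(a))$, $\delta\delta(a)=\bigcup_{x\in\delta(a)}\delta(x)$. For $a,b\in S_k$: $a\triangleleft^+b$ iff there is $\alpha\in S_{k+1}$ with $a\in\delta(\alpha)$, $\gamma(\alpha)=b$; $<^+$ is its transitive closure; for $k\ge1$, $a\triangleleft^-b$ iff $\gamma(a)\in\delta(b)$ and $<^-$ is its transitive closure. An opetopic cardinal is a positive hypergraph satisfying: globularity (for $a\in S_{\ge2}$, $\gamma\gamma(a)=\gamma\delta(a)\setminus\delta\delta(a)$ and $\delta\gamma(a)=\delta\delta(a)\setminus\gamma\delta(a)$); strictness (each $<^+$ on $S_k$ is a strict partial order, and $<^+$ on $S_0$ is total); disjointness (for $k>0$, no $a,b\in S_k$ are comparable for both $<^+$ and $<^-$); pencil linearity (for $k>0$, $x\in S_{k-1}$, the sets $\{a\in S_k:x\in\delta(a)\}$ and $\{a\in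 S_k:\gamma(a)=x\}$ are linearly ordered by $<^+$). $S$ is principal if for every $0\le k\le\dim S$ the set $S_k\setminus\bigcup_{a\in S_{k+1}}\delta(a)$ has exactly one element; a positive opetope is a principal opetopic cardinal. The associated positive-to-one poset has elements $\bigsqcup_kS_k$, $\dim x=k$ for $x\in S_k$, $y\prec^-x$ iff $y\in\delta(x)$, $y\prec^+x$ iff $y=\gamma(x)$; $\le$ is the reflexive-transitive closure of $\prec=\prec^-\cup\prec^+$. -}

module Defs where

open import Data.Nat using (ℕ; zero; suc; _≤_; _<_)
open import Data.Fin using (Fin)
open import Data.Fin.Subset using (Subset; _∈_; _∉_; Nonempty; ⁅_⁆)
open import Data.Product using (Σ; ∃; ∃-syntax; _×_; _,_)
open import Data.Sum using (_⊎_)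
open import Relation.Nullary using (¬_)
open import Relation.Binary.PropositionalEquality using (_≡_)
open import Relation.Binary.Construct.Closure.Transitive using (TransClosure)
open import Relation.Binary.Construct.Closure.ReflexiveTransitive using (Star)
open import Function.Bundles using (_⇔_)

-- A positive hypergraph.  S_k is represented as Fin (size k).
record PositiveHypergraph : Set where
  field
    size     : ℕ → ℕ
    γ        : (k : ℕ) → Fin (size (suc k)) → Fin (size k)
    δ        : (k : ℕ) → Fin (size (suc k)) → Subset (size k)
    finite   : ∃[ N ] (∀ k → N ≤ k → size k ≡ 0)
    δ-nonempty : ∀ k (a : Fin (size (suc k))) → Nonempty (δ k a)
    δ-single : ∀ (a : Fin (size 1)) → ∃[ x ] (δ 0 a ≡ ⁅ x ⁆)

module _ (S : PositiveHypergraph) where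
  open PositiveHypergraph S

  _◁⁺_ : ∀ {k} → Fin (size k) → Fin (size k) → Set
  _◁⁺_ {k} a b = ∃[ α ] (a ∈ δ k α × γ k α ≡ b)

  _<⁺_ : ∀ {k} → Fin (size k) → Fin (size k) → Set
  _<⁺_ {k} = TransClosure (_◁⁺_ {k})

  _◁⁻_ : ∀ {k} → Fin (size (suc k)) → Fin (size (suc k)) → Set
  _◁⁻_ {k} a b = γ k a ∈ δ k b

  _<⁻_ : ∀ {k} → Fin (size (suc k)) → Fin (size (suc k)) → Set
  _<⁻_ {k} = TransClosure (_◁⁻_ {k})

  Globular : Set
  Globular = ∀ k (a : Fin (size (suc (suc k)))) (x : Fin (size k)) →
    -- γγ(a) = γδ(a) \ δδ(a)
    ((x ≡ γ k (γ (suc k) a)) ⇔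
      ((∃[ y ] (y ∈ δ (suc k) a × γ k y ≡ x)) × ¬ (∃[ y ] (y ∈ δ (suc k) a × x ∈ δ k y))))
    -- δγ(a) = δδ(a) \ γδ(a)
    × ((x ∈ δ k (γ (suc k) a)) ⇔
      ((∃[ y ] (y ∈ δ (suc k) a × x ∈ δ k y)) × ¬ (∃[ y ] (y ∈ δ (suc k) a × γ k y ≡ x))))

  Strict : Set
  Strict = (∀ k (a : Fin (size k)) → ¬ (a <⁺ a))
         × (∀ (a b : Fin (size 0)) → a ≡ b ⊎ a <⁺ b ⊎ b <⁺ a)

  Disjoint : Set
  Disjoint = ∀ k (a b : Fin (size (suc k))) →
    ¬ ((a <⁺ b ⊎ b <⁺ a) × (a <⁻ b ⊎ b <⁻ a))

  PencilLinear : Set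
  PencilLinear = ∀ k (x : Fin (size k)) (a b : Fin (size (suc k))) →
      (x ∈ δ k a → x ∈ δ k b → a ≡ b ⊎ a <⁺ b ⊎ b <⁺ a)
    × (γ k a ≡ x → γ k b ≡ x → a ≡ b ⊎ a <⁺ b ⊎ b <⁺ a)

  IsOpetopicCardinal : Set
  IsOpetopicCardinal = Globular × Strict × Disjoint × PencilLinear

  NotInSource : (k : ℕ) → Fin (size k) → Set
  NotInSource k x = ∀ (a : Fin (size (suc k))) → x ∉ δ k a

  -- k ≤ dim S  (dim S = max {j : S_j ≠ ∅})
  _≤dim : ℕ → Set
  k ≤dim = ∃[ j ] (k ≤ j × Fin (size j))

  IsPrincipal : Set
  IsPrincipal = ∀ k → k ≤dim →
    ∃[ x ] (NotInSource k x × (∀ y → NotInSource k y → y ≡ x))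

  Elem : Set
  Elem = Σ ℕ (λ k → Fin (size k))

  data _≺_ : Elem → Elem → Set where
    ≺⁻ : ∀ {k} (x : Fin (size (suc k))) (y : Fin (size k)) →
         y ∈ δ k x → (k , y) ≺ (suc k , x)
    ≺⁺ : ∀ {k} (x : Fin (size (suc k))) (y : Fin (size k)) →
         y ≡ γ k x → (k , y) ≺ (suc k , x)

  _≼_ : Elem → Elem → Set
  _≼_ = Star _≺_

  HasGreatest : Set
  HasGreatest = ∃[ t ] (∀ x → x ≼ t)

{-# OPTIONS --safe #-}
-- Let t be the greatest element and n its dimension.  Everything lies below t, so
-- nothing has dimension > n and t is the only dimension-n cell outside all sources.
-- Below n, a cell y outside all sources is not t, hence y = γ a for some a.
-- Climbing from a along ◁⁺ (which terminates, <⁺ being a strict order on a finite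
-- set) keeps the target fixed: if a ∈ δ α and γ a is in no source, globularity gives
-- γ γ α = γ a.  The climb ends at a (k+1)-cell outside all sources, which by downward
-- induction is the unique such cell m, so y = γ m.
module Submission where

open import Defs
open import Data.Nat using (ℕ; zero; suc; _≤_; _<_; _+_; _∸_; s≤s)
open import Data.Nat.Properties
  using (≤-refl; ≤-trans; n≤1+n; 1+n≰n; <-irrefl; +-suc; m≤n+m; m∸n+n≡m; ≡-irrelevant)
open import Data.Fin using (Fin)
open import Data.Fin.Subset using (_∈_)
open import Data.Fin.Subset.Properties using (_∈?_)
open import Data.Fin.Properties using (any?)
open import Data.Fin.Induction using (spo-noetherian)
open import Data.Product using (∃-syntax; _×_; _,_; proj₁)
open import Data.Product.Properties using (,-injectiveʳ-UIP)
open import Data.Sum using (_⊎_; inj₁; inj₂)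
open import Data.Unit using (⊤; tt)
open import Data.Empty using (⊥-elim)
open import Relation.Nullary using (¬_; yes; no)
open import Relation.Binary.PropositionalEquality
open import Relation.Binary.Construct.Closure.Transitive using ([_])
import Relation.Binary.Construct.Closure.Transitive as TransClosure
open import Relation.Binary.Construct.Closure.ReflexiveTransitive using (ε; _◅_)
open import Relation.Binary.Structures using (IsStrictPartialOrder)
open import Induction.WellFounded using (Acc; acc)
open import Function.Base using (flip)
open import Function.Bundles using (Equivalence)

module _ (S : PositiveHypergraph) where
  open PositiveHypergraph S

  UniqueNotInSource : ℕ → Set
  UniqueNotInSource k =
    ∃[ x ] (NotInSource S k x × (∀ y → NotInSource S k y → y ≡ x))

  <⁺-isStrictPartialOrder : ∀ {k} → (∀ (a : Fin (size k)) → ¬ (_<⁺_ S a a)) →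
    IsStrictPartialOrder _≡_ (_<⁺_ S {k})
  <⁺-isStrictPartialOrder irrefl = record
    { isEquivalence = isEquivalence
    ; irrefl        = λ { refl → irrefl _ }
    ; trans         = TransClosure.transitive _
    ; <-resp-≈      = (λ { refl a<b → a<b }) , (λ { refl a<b → a<b })
    }

  climb-to-notInSource : ∀ {k} → (∀ (a : Fin (size k)) → ¬ (_<⁺_ S a a)) →
    (P : Fin (size k) → Set) → (∀ {a} α → a ∈ δ k α → P a → P (γ k α)) →
    ∀ a → P a → ∃[ b ] (NotInSource S k b × P b)
  climb-to-notInSource {k} irrefl P P-step a =
    go a (spo-noetherian (<⁺-isStrictPartialOrder irrefl) a)
    where
    go : ∀ a → Acc (flip (_<⁺_ S)) a → P a → ∃[ b ] (NotInSource S k b × P b)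
    go a (acc above) Pa with any? (λ α → a ∈? δ k α)
    ... | no a∉δ         = a , (λ α a∈δα → a∉δ (α , a∈δα)) , Pa
    ... | yes (α , a∈δα) = go (γ k α) (above [ α , a∈δα , refl ]) (P-step α a∈δα Pa)

  ∃-notInSource : ∀ {k} → (∀ (a : Fin (size k)) → ¬ (_<⁺_ S a a)) →
    Fin (size k) → ∃[ x ] NotInSource S k x
  ∃-notInSource irrefl a with climb-to-notInSource irrefl (λ _ → ⊤) (λ _ _ _ → tt) a tt
  ... | x , x∉δ , _ = x , x∉δ

  γ-notInSource⇒γγ : Globular S → ∀ {k} (α : Fin (size (suc (suc k)))) {a} →
    a ∈ δ (suc k) α → NotInSource S k (γ k a) → γ k a ≡ γ k (γ (suc k) α)
  γ-notInSource⇒γγ glob α {a} a∈δα γa∉δ =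
    Equivalence.from (proj₁ (glob _ α (γ _ a)))
      ((a , a∈δα , refl) , λ { (y , _ , γa∈δy) → γa∉δ y γa∈δy })

  γ-notInSource-lift : Globular S →
    ∀ {k} → (∀ (a : Fin (size (suc k))) → ¬ (_<⁺_ S a a)) →
    ∀ a → NotInSource S k (γ k a) →
    ∃[ b ] (NotInSource S (suc k) b × γ k b ≡ γ k a)
  γ-notInSource-lift glob {k} irrefl a γa∉δ =
    climb-to-notInSource irrefl (λ b → γ k b ≡ γ k a) step a refl
    where
    step : ∀ {b} α → b ∈ δ (suc k) α → γ k b ≡ γ k a → γ k (γ (suc k) α) ≡ γ k a
    step α b∈δα γb≡γa =
      trans (sym (γ-notInSource⇒γγ glob α b∈δα (subst (NotInSource S k) (sym γb≡γa) γa∉δ)))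
            γb≡γa

  ≼⇒dim≤ : ∀ {e e′} → _≼_ S e e′ → proj₁ e ≤ proj₁ e′
  ≼⇒dim≤ ε                 = ≤-refl
  ≼⇒dim≤ (≺⁻ _ _ _ ◅ e≼e′) = ≤-trans (n≤1+n _) (≼⇒dim≤ e≼e′)
  ≼⇒dim≤ (≺⁺ _ _ _ ◅ e≼e′) = ≤-trans (n≤1+n _) (≼⇒dim≤ e≼e′)

  ≼-cover : ∀ {k} {x : Fin (size k)} {e} → _≼_ S (k , x) e →
    (k , x) ≡ e ⊎ ∃[ a ] (x ∈ δ k a ⊎ x ≡ γ k a)
  ≼-cover ε                 = inj₁ refl
  ≼-cover (≺⁻ a _ x∈δa ◅ _) = inj₂ (a , inj₁ x∈δa)
  ≼-cover (≺⁺ a _ x≡γa ◅ _) = inj₂ (a , inj₂ x≡γa)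

module WithGreatest (S : PositiveHypergraph) (glob : Globular S)
  (irrefl : ∀ k (a : Fin (PositiveHypergraph.size S k)) → ¬ (_<⁺_ S a a))
  (n : ℕ) (t : Fin (PositiveHypergraph.size S n)) (greatest : ∀ e → _≼_ S e (n , t))
  where
  open PositiveHypergraph S

  dim≤n : ∀ k (x : Fin (size k)) → k ≤ n
  dim≤n k x = ≼⇒dim≤ S (greatest (k , x))

  unique-at-top : UniqueNotInSource S n
  unique-at-top = t , (λ a _ → ⊥-elim (1+n≰n (dim≤n _ a))) , below-t
    where
    below-t : ∀ y → NotInSource S n y → y ≡ t
    below-t y _ with ≼-cover S (greatest (n , y))
    ... | inj₁ y≡t     = ,-injectiveʳ-UIP ≡-irrelevant y≡t
    ... | inj₂ (a , _) = ⊥-elim (1+n≰n (dim≤n _ a))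

  notInSource-below-top⇒γ : ∀ {k} → k < n → ∀ y → NotInSource S k y →
    ∃[ a ] (γ k a ≡ y)
  notInSource-below-top⇒γ k<n y y∉δ with ≼-cover S (greatest (_ , y))
  ... | inj₁ y≡t              = ⊥-elim (<-irrefl (cong proj₁ y≡t) k<n)
  ... | inj₂ (a , inj₁ y∈δa) = ⊥-elim (y∉δ a y∈δa)
  ... | inj₂ (a , inj₂ y≡γa) = a , sym y≡γa

  unique-step-down : ∀ {k} → k < n → UniqueNotInSource S (suc k) → UniqueNotInSource S k
  unique-step-down {k} k<n (m , _ , m-unique) with ∃-notInSource S (irrefl k) (γ k m)
  ... | x , x∉δ = γ k m , subst (NotInSource S k) (≡γm x x∉δ) x∉δ , ≡γm
    where
    ≡γm : ∀ y → NotInSource S k y → y ≡ γ k m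
    ≡γm y y∉δ with notInSource-below-top⇒γ k<n y y∉δ
    ... | a , refl with γ-notInSource-lift S glob (irrefl (suc k)) a y∉δ
    ...   | b , b∉δ , γb≡γa = trans (sym γb≡γa) (cong (γ k) (m-unique b b∉δ))

  unique-below-top : ∀ d {k} → d + k ≡ n → UniqueNotInSource S k
  unique-below-top zero    refl = unique-at-top
  unique-below-top (suc d) {k} d+1+k≡n =
    unique-step-down (subst (k <_) d+1+k≡n (s≤s (m≤n+m k d)))
      (unique-below-top d (trans (+-suc d k) d+1+k≡n))

  principal : IsPrincipal S
  principal k (j , k≤j , y) = unique-below-top (n ∸ k) (m∸n+n≡m (≤-trans k≤j (dim≤n j y)))

mainTheorem3 : (S : PositiveHypergraph) → IsOpetopicCardinal S → HasGreatest S →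
    IsPrincipal S
mainTheorem3 S (glob , (irrefl , _) , _) ((n , t) , greatest) =
  WithGreatest.principal S glob irrefl n t greatest
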